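{- Let $d$ be a nonnegative integer, let $P\subset\mathbb{R}^d$ be a convex lattice polytope, and let $n$ be a positive integer. For each $i\in\{1,\dots,n\}$, the number of horizontal lattice copies of $P$ in $nP$ with scale factor $i$, i.e. the number of polytopes of the form $iP+a$ with $a\in\mathbb{Z}^d$ and $iP+a\subset nP$, equals $L_P(n-i)$.
   Context: A lattice polytope is a polytope all of whose vertices lie in $\mathbb{Z}^d$. For a bounded convex set $S\subset\mathbb{R}^d$ and nonnegative integer $t$, $L_S(t):=\#(tS\cap\mathbb{Z}^d)$, where $tS$ is the $t$-th dilate of $S$ (so $0S=\{0\}$). -}

module Defs where

open import Data.Nat using (ℕ; zero; suc)
open import Data.Integer using (ℤ; +_)
open import Data.Rational using (ℚ; 0ℚ; 1ℚ; _/_; _+_; _*_; _≤_)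
open import Data.Vec using (Vec; []; _∷_; map; zipWith; replicate)
open import Data.Vec.Relation.Unary.All using (All)
open import Data.List using (List; length)
open import Data.List.Membership.Propositional using (_∈_)
open import Data.List.Relation.Unary.Unique.Propositional using (Unique)
open import Data.Product using (Σ; _×_; ∃)
open import Relation.Binary.PropositionalEquality using (_≡_)

ℤ^ : ℕ → Set
ℤ^ d = Vec ℤ d

ℚ^ : ℕ → Set
ℚ^ d = Vec ℚ d

ℤtoℚ : ℤ → ℚ
ℤtoℚ z = z / 1

embed : ∀ {d} → ℤ^ d → ℚ^ d
embed = map ℤtoℚ

-- A lattice polytope in dimension d: convex hull of a nonempty finite list
-- of lattice points (its vertices / generating points).
record LatticePolytope (d : ℕ) : Set where
  constructor polytope
  field
    k        : ℕ
    vertices : Vec (ℤ^ d) (suc k)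

lincomb : ∀ {d k} → Vec ℚ k → Vec (ℤ^ d) k → ℚ^ d
lincomb {d} [] [] = replicate d 0ℚ
lincomb (l ∷ ls) (v ∷ vs) = zipWith _+_ (map (l *_) (embed v)) (lincomb ls vs)

sumℚ : ∀ {k} → Vec ℚ k → ℚ
sumℚ [] = 0ℚ
sumℚ (x ∷ xs) = x + sumℚ xs

_∈P_ : ∀ {d} → ℚ^ d → LatticePolytope d → Set
x ∈P P = Σ (Vec ℚ (suc k)) λ λs →
           All (0ℚ ≤_) λs × sumℚ λs ≡ 1ℚ × lincomb λs vertices ≡ x
  where open LatticePolytope P

_·_ : ∀ {d} → ℕ → ℚ^ d → ℚ^ d
t · y = map ((+ t / 1) *_) y

-- x ∈ tP,  where tP = { t y : y ∈ P }  (so 0P = {0})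
InDilate : ∀ {d} → ℕ → LatticePolytope d → ℚ^ d → Set
InDilate t P x = ∃ λ y → y ∈P P × x ≡ t · y

InTranslate : ∀ {d} → ℕ → ℤ^ d → LatticePolytope d → ℚ^ d → Set
InTranslate i a P x = ∃ λ y → InDilate i P y × x ≡ zipWith _+_ y (embed a)

TranslateInside : ∀ {d} → ℕ → ℤ^ d → ℕ → LatticePolytope d → Set
TranslateInside i a n P = ∀ x → InTranslate i a P x → InDilate n P x

-- "the set {a ∈ ℤ^d | Q a} has exactly m elements":
-- there is a duplicate-free list of length m whose members are exactly those a
HasCount : ∀ {d} → (ℤ^ d → Set) → ℕ → Set
HasCount {d} Q m = Σ (List (ℤ^ d)) λ xs →
  Unique xs × length xs ≡ m × (∀ a → (a ∈ xs → Q a) × (Q a → a ∈ xs))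

LatticeCount : ∀ {d} → LatticePolytope d → ℕ → ℕ → Set
LatticeCount P t m = HasCount (λ z → InDilate t P (embed z)) m

{-# OPTIONS --safe #-}

-- For a ∈ ℤᵈ, iP + a ⊆ nP holds exactly when a ∈ (n − i)P, so both sides count the same set.
-- If a = (n − i)z with z ∈ P, then iy + a = n((i/n)y + ((n − i)/n)z) ∈ nP for every y ∈ P.
-- Conversely, if iP + a ⊆ nP, then i vⱼ + a = n Σₗ Λⱼₗ vₗ for the vertices vⱼ of P and some
-- row-stochastic matrix Λ. A stationary distribution μ = μΛ, which Grassmann–Taksar–Heyman state
-- reduction constructs, gives i z + a = n z for z = Σⱼ μⱼ vⱼ ∈ P, that is a = (n − i)z.
-- The count exists constructively because the lattice points of tP lie in an explicit box and
-- membership in tP is a rational linear feasibility problem, decided by Fourier–Motzkin elimination.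

module Submission where

open import Defs
open import Data.Nat as ℕ using (ℕ; zero; suc; _≤_; _∸_)
import Data.Nat.Properties as ℕ
open import Data.Integer as ℤ using (ℤ)
import Data.Integer.Properties as ℤ
open import Data.Rational
  using (ℚ; 0ℚ; 1ℚ; _/_; _+_; _*_; _-_; -_; 1/_; ∣_∣; NonZero; positive; nonNegative)
  renaming (_≤_ to _≤ℚ_; _<_ to _<ℚ_)
open import Data.Rational.Base using (*≤*)
import Data.Rational.Properties as ℚ
open import Data.Rational.Literals using (fromℤ)
open import Data.Rational.Solver using (module +-*-Solver)
open +-*-Solver using (solve; _:+_; _:*_; _:-_; :-_; con; _:=_)
open import Data.Fin using (Fin; zero; suc)
open import Data.Vec using (Vec; []; _∷_; map; zipWith; replicate; head; tail; lookup; tabulate; sum)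
import Data.Vec.Properties as Vec
open import Data.Vec.Relation.Unary.All as All using (All; []; _∷_)
import Data.Vec.Relation.Unary.All.Properties as Allₚ
open import Data.List as List using (List; []; _∷_; _++_; cartesianProductWith; length; filter; deduplicate)
open import Data.List.Membership.Propositional using (_∈_)
open import Data.List.Membership.Propositional.Properties
  using (∈-++⁺ˡ; ∈-++⁺ʳ; ∈-map⁺; ∈-upTo⁺; ∈-cartesianProductWith⁺; ∈-filter⁺; ∈-filter⁻; ∈-deduplicate⁺; ∈-deduplicate⁻)
open import Data.List.Relation.Unary.Any using (here)
open import Data.List.Relation.Unary.All as ListAll using ([]; _∷_)
import Data.List.Relation.Unary.All.Properties as ListAllₚ
open import Function.Bundles using (_⇔_; mk⇔; module Equivalence)
import Function.Properties.Equivalence as ⇔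
open import Function.Base using (_∘_)
open import Data.Product as Product using (Σ; ∃; _×_; _,_; proj₁; proj₂; map₁; map₂)
open import Relation.Nullary using (Dec)
open import Relation.Nullary.Decidable using (map′)
open import Data.Empty using (⊥-elim)
open import Relation.Binary.Bundles using (DecTotalOrder)
open import Relation.Binary.Definitions using (DecidableEquality; tri<; tri≈; tri>)
import Data.List.Relation.Unary.Unique.DecPropositional.Properties as Unique
open import Relation.Binary.PropositionalEquality
import Data.List.Extrema (DecTotalOrder.totalOrder ℚ.≤-decTotalOrder) as Extrema

private variable
  k m n : ℕ
  p q r s : ℚ

≤-shift⇔ : ∀ c → p + c ≡ r → q + c ≡ s → (p ≤ℚ q) ⇔ (r ≤ℚ s)
≤-shift⇔ {p = p} {q = q} c refl refl =
  mk⇔ (ℚ.+-monoˡ-≤ c) (λ h → subst₂ _≤ℚ_ (cancel p) (cancel q) (ℚ.+-monoˡ-≤ (- c) h))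
  where
  cancel : ∀ x → x + c - c ≡ x
  cancel x = solve 2 (λ x c → x :+ c :- c := x) refl x c

nonNeg+ : 0ℚ ≤ℚ p → 0ℚ ≤ℚ q → 0ℚ ≤ℚ p + q
nonNeg+ = ℚ.+-mono-≤

nonNeg* : 0ℚ ≤ℚ p → 0ℚ ≤ℚ q → 0ℚ ≤ℚ p * q
nonNeg* {p} {q} 0≤p 0≤q =
  ℚ.nonNegative⁻¹ (p * q) {{ℚ.nonNeg*nonNeg⇒nonNeg p {{nonNegative 0≤p}} q {{nonNegative 0≤q}}}}

1/pos-nonNeg : (0<p : 0ℚ <ℚ p) → 0ℚ ≤ℚ (1/ p) {{ℚ.pos⇒nonZero p {{positive 0<p}}}}
1/pos-nonNeg {p} 0<p = ℚ.<⇒≤ (ℚ.positive⁻¹ _ {{ℚ.1/pos⇒pos p {{positive 0<p}}}})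

p*[q*1/p]≡q : ∀ p .{{_ : NonZero p}} q → p * (q * 1/ p) ≡ q
p*[q*1/p]≡q p q = begin
  p * (q * 1/ p) ≡⟨ solve 3 (λ p q r → p :* (q :* r) := q :* (p :* r)) refl p q (1/ p) ⟩
  q * (p * 1/ p) ≡⟨ cong (q *_) (ℚ.*-inverseʳ p) ⟩
  q * 1ℚ         ≡⟨ ℚ.*-identityʳ q ⟩
  q              ∎
  where open ≡-Reasoning

nonNeg+nonNeg≡0⇒≡0 : 0ℚ ≤ℚ p → 0ℚ ≤ℚ q → p + q ≡ 0ℚ → p ≡ 0ℚ
nonNeg+nonNeg≡0⇒≡0 {p} {q} 0≤p 0≤q p+q≡0 =
  ℚ.≤-antisym (Equivalence.to (≤-shift⇔ p (ℚ.+-identityˡ p) (trans (ℚ.+-comm q p) p+q≡0)) 0≤q) 0≤p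

∣*∣≤ : ∀ {a y S} → 0ℚ ≤ℚ a → ∣ y ∣ ≤ℚ S → ∣ a * y ∣ ≤ℚ a * S
∣*∣≤ {a} {y} 0≤a ∣y∣≤S = subst (_≤ℚ a * _) (sym (trans (ℚ.∣p*q∣≡∣p∣*∣q∣ a y) (cong (_* ∣ y ∣) (ℚ.0≤p⇒∣p∣≡p 0≤a))))
                                 (ℚ.*-monoˡ-≤-nonNeg a {{nonNegative 0≤a}} ∣y∣≤S)

ℤtoℚ≡fromℤ : ∀ z → ℤtoℚ z ≡ fromℤ z
ℤtoℚ≡fromℤ z = ℚ.↥p/↧p≡p (fromℤ z)

ℤtoℚ-+ : ∀ a b → ℤtoℚ (a ℤ.+ b) ≡ ℤtoℚ a + ℤtoℚ b
ℤtoℚ-+ a b = begin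
  ℤtoℚ (a ℤ.+ b)                 ≡⟨ ℚ./-cong {p₁ = a ℤ.+ b} {q₁ = 1} (sym (cong₂ ℤ._+_ (ℤ.*-identityʳ a) (ℤ.*-identityʳ b))) refl ⟩
  (a ℤ.* ℤ.1ℤ ℤ.+ b ℤ.* ℤ.1ℤ) / 1 ≡⟨ cong₂ _+_ (ℤtoℚ≡fromℤ a) (ℤtoℚ≡fromℤ b) ⟨
  ℤtoℚ a + ℤtoℚ b ∎
  where open ≡-Reasoning

ℤtoℚ-* : ∀ a b → ℤtoℚ (a ℤ.* b) ≡ ℤtoℚ a * ℤtoℚ b
ℤtoℚ-* a b = sym (cong₂ _*_ (ℤtoℚ≡fromℤ a) (ℤtoℚ≡fromℤ b))

ℤtoℚ-mono-≤ : ∀ {a b} → a ℤ.≤ b → ℤtoℚ a ≤ℚ ℤtoℚ b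
ℤtoℚ-mono-≤ {a} {b} a≤b = subst₂ _≤ℚ_ (sym (ℤtoℚ≡fromℤ a)) (sym (ℤtoℚ≡fromℤ b))
  (*≤* (subst₂ ℤ._≤_ (sym (ℤ.*-identityʳ a)) (sym (ℤ.*-identityʳ b)) a≤b))

ℤtoℚ-cancel-≤ : ∀ {a b} → ℤtoℚ a ≤ℚ ℤtoℚ b → a ℤ.≤ b
ℤtoℚ-cancel-≤ {a} {b} a≤b with subst₂ _≤ℚ_ (ℤtoℚ≡fromℤ a) (ℤtoℚ≡fromℤ b) a≤b
... | *≤* a*1≤b*1 = subst₂ ℤ._≤_ (ℤ.*-identityʳ a) (ℤ.*-identityʳ b) a*1≤b*1

∣ℤtoℚ∣ : ∀ z → ∣ ℤtoℚ z ∣ ≡ ℤtoℚ (ℤ.+ ℤ.∣ z ∣)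
∣ℤtoℚ∣ z = trans (cong ∣_∣ (ℤtoℚ≡fromℤ z)) (sym (ℤtoℚ≡fromℤ (ℤ.+ ℤ.∣ z ∣)))

ℕtoℚ : ℕ → ℚ
ℕtoℚ t = ℤtoℚ (ℤ.+ t)

ℕtoℚ-+ : ∀ m n → ℕtoℚ (m ℕ.+ n) ≡ ℕtoℚ m + ℕtoℚ n
ℕtoℚ-+ m n = ℤtoℚ-+ (ℤ.+ m) (ℤ.+ n)

ℕtoℚ-* : ∀ m n → ℕtoℚ (m ℕ.* n) ≡ ℕtoℚ m * ℕtoℚ n
ℕtoℚ-* m n = trans (cong ℤtoℚ (ℤ.pos-* m n)) (ℤtoℚ-* (ℤ.+ m) (ℤ.+ n))

ℕtoℚ-∸ : ∀ {m n} → n ≤ m → ℕtoℚ (m ∸ n) ≡ ℕtoℚ m - ℕtoℚ n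
ℕtoℚ-∸ {m} {n} n≤m = begin
  ℕtoℚ (m ∸ n)                        ≡⟨ solve 2 (λ a b → a := a :+ b :- b) refl (ℕtoℚ (m ∸ n)) (ℕtoℚ n) ⟩
  ℕtoℚ (m ∸ n) + ℕtoℚ n - ℕtoℚ n      ≡⟨ cong (_- ℕtoℚ n) (ℕtoℚ-+ (m ∸ n) n) ⟨
  ℕtoℚ (m ∸ n ℕ.+ n) - ℕtoℚ n         ≡⟨ cong (λ k → ℕtoℚ k - ℕtoℚ n) (ℕ.m∸n+n≡m n≤m) ⟩
  ℕtoℚ m - ℕtoℚ n                     ∎
  where open ≡-Reasoning

ℕtoℚ-nonNeg : ∀ t → 0ℚ ≤ℚ ℕtoℚ t
ℕtoℚ-nonNeg t = ℤtoℚ-mono-≤ {ℤ.+ 0} {ℤ.+ t} (ℤ.+≤+ ℕ.z≤n)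

ℕtoℚ-pos : ∀ {t} → 1 ≤ t → 0ℚ <ℚ ℕtoℚ t
ℕtoℚ-pos {suc t} _ = subst (0ℚ <ℚ_) (sym (ℤtoℚ≡fromℤ (ℤ.+ suc t))) (ℚ.positive⁻¹ _)

∣ℤtoℚ∣≤ℕtoℚ⇔ : ∀ c B → (∣ ℤtoℚ c ∣ ≤ℚ ℕtoℚ B) ⇔ (ℤ.∣ c ∣ ≤ B)
∣ℤtoℚ∣≤ℕtoℚ⇔ c B = mk⇔
  (λ h → ℤ.drop‿+≤+ (ℤtoℚ-cancel-≤ (subst (_≤ℚ ℕtoℚ B) (∣ℤtoℚ∣ c) h)))
  (λ h → subst (_≤ℚ ℕtoℚ B) (sym (∣ℤtoℚ∣ c)) (ℤtoℚ-mono-≤ (ℤ.+≤+ h)))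

infixl 6 _⊕_
infixr 7 _⊙_

_⊕_ : Vec ℚ n → Vec ℚ n → Vec ℚ n
_⊕_ = zipWith _+_

_⊙_ : ℚ → Vec ℚ n → Vec ℚ n
c ⊙ v = map (c *_) v

0ᵥ : Vec ℚ n
0ᵥ = replicate _ 0ℚ

dot : Vec ℚ n → Vec ℚ n → ℚ
dot []       []       = 0ℚ
dot (a ∷ as) (x ∷ xs) = a * x + dot as xs

lincombℚ : Vec ℚ k → Vec (Vec ℚ n) k → Vec ℚ n
lincombℚ []       []       = 0ᵥ
lincombℚ (l ∷ ls) (w ∷ ws) = l ⊙ w ⊕ lincombℚ ls ws

NonNeg : Vec ℚ n → Set
NonNeg = All (0ℚ ≤ℚ_)

Stochastic : Vec ℚ n → Set
Stochastic v = NonNeg v × sumℚ v ≡ 1ℚ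

lincomb≡lincombℚ : ∀ {d} (ls : Vec ℚ k) (vs : Vec (ℤ^ d) k) → lincomb ls vs ≡ lincombℚ ls (map embed vs)
lincomb≡lincombℚ []       []       = refl
lincomb≡lincombℚ (l ∷ ls) (v ∷ vs) = cong (l ⊙ embed v ⊕_) (lincomb≡lincombℚ ls vs)

⊕-comm : (u v : Vec ℚ n) → u ⊕ v ≡ v ⊕ u
⊕-comm = Vec.zipWith-comm ℚ.+-comm

⊕-assoc : (u v w : Vec ℚ n) → u ⊕ v ⊕ w ≡ u ⊕ (v ⊕ w)
⊕-assoc = Vec.zipWith-assoc ℚ.+-assoc

⊕-identityˡ : (v : Vec ℚ n) → 0ᵥ ⊕ v ≡ v
⊕-identityˡ = Vec.zipWith-identityˡ ℚ.+-identityˡ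

⊕-identityʳ : (v : Vec ℚ n) → v ⊕ 0ᵥ ≡ v
⊕-identityʳ = Vec.zipWith-identityʳ ℚ.+-identityʳ

⊕-interchange : (u v w x : Vec ℚ n) → u ⊕ v ⊕ (w ⊕ x) ≡ u ⊕ w ⊕ (v ⊕ x)
⊕-interchange u v w x = begin
  u ⊕ v ⊕ (w ⊕ x)   ≡⟨ ⊕-assoc u v (w ⊕ x) ⟩
  u ⊕ (v ⊕ (w ⊕ x)) ≡⟨ cong (u ⊕_) (⊕-assoc v w x) ⟨
  u ⊕ (v ⊕ w ⊕ x)   ≡⟨ cong (λ y → u ⊕ (y ⊕ x)) (⊕-comm v w) ⟩
  u ⊕ (w ⊕ v ⊕ x)   ≡⟨ cong (u ⊕_) (⊕-assoc w v x) ⟩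
  u ⊕ (w ⊕ (v ⊕ x)) ≡⟨ ⊕-assoc u w (v ⊕ x) ⟨
  u ⊕ w ⊕ (v ⊕ x)   ∎
  where open ≡-Reasoning

⊙-distribˡ-⊕ : ∀ c (u v : Vec ℚ n) → c ⊙ (u ⊕ v) ≡ c ⊙ u ⊕ c ⊙ v
⊙-distribˡ-⊕ c []       []       = refl
⊙-distribˡ-⊕ c (a ∷ u) (b ∷ v) = cong₂ _∷_ (ℚ.*-distribˡ-+ c a b) (⊙-distribˡ-⊕ c u v)

⊙-distribʳ-+ : ∀ c d (v : Vec ℚ n) → (c + d) ⊙ v ≡ c ⊙ v ⊕ d ⊙ v
⊙-distribʳ-+ c d []      = refl
⊙-distribʳ-+ c d (a ∷ v) = cong₂ _∷_ (ℚ.*-distribʳ-+ a c d) (⊙-distribʳ-+ c d v)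

⊙-assoc : ∀ c d (v : Vec ℚ n) → c ⊙ d ⊙ v ≡ (c * d) ⊙ v
⊙-assoc c d v = trans (sym (Vec.map-∘ (c *_) (d *_) v)) (Vec.map-cong (λ a → sym (ℚ.*-assoc c d a)) v)

⊙-identityˡ : (v : Vec ℚ n) → 1ℚ ⊙ v ≡ v
⊙-identityˡ v = trans (Vec.map-cong ℚ.*-identityˡ v) (Vec.map-id v)

⊙-zeroˡ : (v : Vec ℚ n) → 0ℚ ⊙ v ≡ 0ᵥ
⊙-zeroˡ v = trans (Vec.map-cong ℚ.*-zeroˡ v) (Vec.map-const v 0ℚ)

⊙-zeroʳ : ∀ c → c ⊙ 0ᵥ {n} ≡ 0ᵥ
⊙-zeroʳ {n} c = trans (Vec.map-replicate (c *_) 0ℚ n) (cong (replicate n) (ℚ.*-zeroʳ c))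

lincombℚ-zeroˡ : (W : Vec (Vec ℚ n) k) → lincombℚ 0ᵥ W ≡ 0ᵥ
lincombℚ-zeroˡ []      = refl
lincombℚ-zeroˡ (w ∷ W) = trans (cong₂ _⊕_ (⊙-zeroˡ w) (lincombℚ-zeroˡ W)) (⊕-identityˡ 0ᵥ)

lincombℚ-distrib-⊕ : (l m : Vec ℚ k) (W : Vec (Vec ℚ n) k) →
                     lincombℚ (l ⊕ m) W ≡ lincombℚ l W ⊕ lincombℚ m W
lincombℚ-distrib-⊕ []      []      []      = sym (⊕-identityˡ 0ᵥ)
lincombℚ-distrib-⊕ (a ∷ l) (b ∷ m) (w ∷ W) = begin
  (a + b) ⊙ w ⊕ lincombℚ (l ⊕ m) W               ≡⟨ cong₂ _⊕_ (⊙-distribʳ-+ a b w) (lincombℚ-distrib-⊕ l m W) ⟩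
  a ⊙ w ⊕ b ⊙ w ⊕ (lincombℚ l W ⊕ lincombℚ m W) ≡⟨ ⊕-interchange (a ⊙ w) (b ⊙ w) _ _ ⟩
  a ⊙ w ⊕ lincombℚ l W ⊕ (b ⊙ w ⊕ lincombℚ m W) ∎
  where open ≡-Reasoning

lincombℚ-⊙ : ∀ c (l : Vec ℚ k) (W : Vec (Vec ℚ n) k) → lincombℚ (c ⊙ l) W ≡ c ⊙ lincombℚ l W
lincombℚ-⊙ c []      []      = sym (⊙-zeroʳ c)
lincombℚ-⊙ c (a ∷ l) (w ∷ W) = begin
  (c * a) ⊙ w ⊕ lincombℚ (c ⊙ l) W ≡⟨ cong₂ _⊕_ (sym (⊙-assoc c a w)) (lincombℚ-⊙ c l W) ⟩
  c ⊙ a ⊙ w ⊕ c ⊙ lincombℚ l W     ≡⟨ ⊙-distribˡ-⊕ c (a ⊙ w) (lincombℚ l W) ⟨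
  c ⊙ (a ⊙ w ⊕ lincombℚ l W)       ∎
  where open ≡-Reasoning

lincombℚ-map-⊙ : ∀ c (μ : Vec ℚ k) (W : Vec (Vec ℚ n) k) →
                 lincombℚ μ (map (c ⊙_) W) ≡ c ⊙ lincombℚ μ W
lincombℚ-map-⊙ c []      []      = sym (⊙-zeroʳ c)
lincombℚ-map-⊙ c (a ∷ μ) (w ∷ W) = begin
  a ⊙ c ⊙ w ⊕ lincombℚ μ (map (c ⊙_) W) ≡⟨ cong₂ _⊕_ (⊙-assoc a c w) (lincombℚ-map-⊙ c μ W) ⟩
  (a * c) ⊙ w ⊕ c ⊙ lincombℚ μ W         ≡⟨ cong (λ b → b ⊙ w ⊕ c ⊙ lincombℚ μ W) (ℚ.*-comm a c) ⟩
  (c * a) ⊙ w ⊕ c ⊙ lincombℚ μ W         ≡⟨ cong (_⊕ c ⊙ lincombℚ μ W) (⊙-assoc c a w) ⟨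
  c ⊙ a ⊙ w ⊕ c ⊙ lincombℚ μ W           ≡⟨ ⊙-distribˡ-⊕ c (a ⊙ w) (lincombℚ μ W) ⟨
  c ⊙ (a ⊙ w ⊕ lincombℚ μ W)             ∎
  where open ≡-Reasoning

lincombℚ-zipWith-⊕ : (μ : Vec ℚ k) (V W : Vec (Vec ℚ n) k) →
                     lincombℚ μ (zipWith _⊕_ V W) ≡ lincombℚ μ V ⊕ lincombℚ μ W
lincombℚ-zipWith-⊕ []      []      []      = sym (⊕-identityˡ 0ᵥ)
lincombℚ-zipWith-⊕ (a ∷ μ) (v ∷ V) (w ∷ W) = begin
  a ⊙ (v ⊕ w) ⊕ lincombℚ μ (zipWith _⊕_ V W)     ≡⟨ cong₂ _⊕_ (⊙-distribˡ-⊕ a v w) (lincombℚ-zipWith-⊕ μ V W) ⟩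
  a ⊙ v ⊕ a ⊙ w ⊕ (lincombℚ μ V ⊕ lincombℚ μ W) ≡⟨ ⊕-interchange (a ⊙ v) (a ⊙ w) _ _ ⟩
  a ⊙ v ⊕ lincombℚ μ V ⊕ (a ⊙ w ⊕ lincombℚ μ W) ∎
  where open ≡-Reasoning

lincombℚ-replicate : (μ : Vec ℚ k) (w : Vec ℚ n) → lincombℚ μ (replicate k w) ≡ sumℚ μ ⊙ w
lincombℚ-replicate []      w = sym (⊙-zeroˡ w)
lincombℚ-replicate (a ∷ μ) w =
  trans (cong (a ⊙ w ⊕_) (lincombℚ-replicate μ w)) (sym (⊙-distribʳ-+ a (sumℚ μ) w))

lincombℚ-affine : ∀ c (a : Vec ℚ n) (μ : Vec ℚ k) (W : Vec (Vec ℚ n) k) →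
                  lincombℚ μ (map (λ w → c ⊙ w ⊕ a) W) ≡ c ⊙ lincombℚ μ W ⊕ sumℚ μ ⊙ a
lincombℚ-affine {k = k} c a μ W = begin
  lincombℚ μ (map (λ w → c ⊙ w ⊕ a) W)                         ≡⟨ cong (lincombℚ μ) affine≡ ⟩
  lincombℚ μ (zipWith _⊕_ (map (c ⊙_) W) (replicate k a))      ≡⟨ lincombℚ-zipWith-⊕ μ _ _ ⟩
  lincombℚ μ (map (c ⊙_) W) ⊕ lincombℚ μ (replicate k a)       ≡⟨ cong₂ _⊕_ (lincombℚ-map-⊙ c μ W) (lincombℚ-replicate μ a) ⟩
  c ⊙ lincombℚ μ W ⊕ sumℚ μ ⊙ a                                ∎
  where
  open ≡-Reasoning
  affine≡ : map (λ w → c ⊙ w ⊕ a) W ≡ zipWith _⊕_ (map (c ⊙_) W) (replicate k a)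
  affine≡ = trans (Vec.map-∘ (_⊕ a) (c ⊙_) W) (sym (Vec.zipWith-replicate₂ _⊕_ (map (c ⊙_) W) a))

lincombℚ-assoc : (μ : Vec ℚ k) (Λ : Vec (Vec ℚ m) k) (W : Vec (Vec ℚ n) m) →
                 lincombℚ μ (map (λ r → lincombℚ r W) Λ) ≡ lincombℚ (lincombℚ μ Λ) W
lincombℚ-assoc []      []      W = sym (lincombℚ-zeroˡ W)
lincombℚ-assoc (a ∷ μ) (r ∷ Λ) W = begin
  a ⊙ lincombℚ r W ⊕ lincombℚ μ (map (λ r → lincombℚ r W) Λ) ≡⟨ cong₂ _⊕_ (sym (lincombℚ-⊙ a r W)) (lincombℚ-assoc μ Λ W) ⟩
  lincombℚ (a ⊙ r) W ⊕ lincombℚ (lincombℚ μ Λ) W              ≡⟨ lincombℚ-distrib-⊕ (a ⊙ r) (lincombℚ μ Λ) W ⟨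
  lincombℚ (a ⊙ r ⊕ lincombℚ μ Λ) W                           ∎
  where open ≡-Reasoning

lincombℚ-∷ : (μ : Vec ℚ k) (R : Vec (Vec ℚ (suc n)) k) →
             lincombℚ μ R ≡ dot (map head R) μ ∷ lincombℚ μ (map tail R)
lincombℚ-∷ []      []            = refl
lincombℚ-∷ (a ∷ μ) ((h ∷ t) ∷ R) = trans (cong (zipWith _+_ (a ⊙ (h ∷ t))) (lincombℚ-∷ μ R))
  (cong (λ x → x + dot (map head R) μ ∷ a ⊙ t ⊕ lincombℚ μ (map tail R)) (ℚ.*-comm a h))

lincombℚ-mix : ∀ c α β (λ₁ λ₂ : Vec ℚ k) (W : Vec (Vec ℚ n) k) →
               c ⊙ lincombℚ (α ⊙ λ₁ ⊕ β ⊙ λ₂) W ≡ (c * α) ⊙ lincombℚ λ₁ W ⊕ (c * β) ⊙ lincombℚ λ₂ W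
lincombℚ-mix c α β λ₁ λ₂ W = begin
  c ⊙ lincombℚ (α ⊙ λ₁ ⊕ β ⊙ λ₂) W                  ≡⟨ cong (c ⊙_) (lincombℚ-distrib-⊕ (α ⊙ λ₁) (β ⊙ λ₂) W) ⟩
  c ⊙ (lincombℚ (α ⊙ λ₁) W ⊕ lincombℚ (β ⊙ λ₂) W)   ≡⟨ cong (c ⊙_) (cong₂ _⊕_ (lincombℚ-⊙ α λ₁ W) (lincombℚ-⊙ β λ₂ W)) ⟩
  c ⊙ (α ⊙ lincombℚ λ₁ W ⊕ β ⊙ lincombℚ λ₂ W)       ≡⟨ ⊙-distribˡ-⊕ c _ _ ⟩
  c ⊙ α ⊙ lincombℚ λ₁ W ⊕ c ⊙ β ⊙ lincombℚ λ₂ W     ≡⟨ cong₂ _⊕_ (⊙-assoc c α _) (⊙-assoc c β _) ⟩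
  (c * α) ⊙ lincombℚ λ₁ W ⊕ (c * β) ⊙ lincombℚ λ₂ W ∎
  where open ≡-Reasoning

sumℚ-⊕ : (u v : Vec ℚ n) → sumℚ (u ⊕ v) ≡ sumℚ u + sumℚ v
sumℚ-⊕ []      []      = refl
sumℚ-⊕ (a ∷ u) (b ∷ v) = trans (cong ((a + b) +_) (sumℚ-⊕ u v))
  (solve 4 (λ a b x y → a :+ b :+ (x :+ y) := a :+ x :+ (b :+ y)) refl a b (sumℚ u) (sumℚ v))

sumℚ-⊙ : ∀ c (v : Vec ℚ n) → sumℚ (c ⊙ v) ≡ c * sumℚ v
sumℚ-⊙ c []      = sym (ℚ.*-zeroʳ c)
sumℚ-⊙ c (a ∷ v) = trans (cong (c * a +_) (sumℚ-⊙ c v)) (sym (ℚ.*-distribˡ-+ c a (sumℚ v)))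

sumℚ-0ᵥ : sumℚ (0ᵥ {n}) ≡ 0ℚ
sumℚ-0ᵥ {zero}  = refl
sumℚ-0ᵥ {suc n} = trans (ℚ.+-identityˡ _) (sumℚ-0ᵥ {n})

dot-⊙ˡ : ∀ c (a x : Vec ℚ n) → dot (c ⊙ a) x ≡ c * dot a x
dot-⊙ˡ c []       []       = sym (ℚ.*-zeroʳ c)
dot-⊙ˡ c (a ∷ as) (x ∷ xs) = trans (cong (c * a * x +_) (dot-⊙ˡ c as xs))
  (solve 4 (λ c a x d → c :* a :* x :+ c :* d := c :* (a :* x :+ d)) refl c a x (dot as xs))

dot-⊕ˡ : (a b x : Vec ℚ n) → dot (a ⊕ b) x ≡ dot a x + dot b x
dot-⊕ˡ []       []       []       = sym (ℚ.+-identityˡ 0ℚ)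
dot-⊕ˡ (a ∷ as) (b ∷ bs) (x ∷ xs) = trans (cong ((a + b) * x +_) (dot-⊕ˡ as bs xs))
  (solve 5 (λ a b x d e → (a :+ b) :* x :+ (d :+ e) := a :* x :+ d :+ (b :* x :+ e))
         refl a b x (dot as xs) (dot bs xs))

dot-zeroˡ : (x : Vec ℚ n) → dot 0ᵥ x ≡ 0ℚ
dot-zeroˡ []      = refl
dot-zeroˡ (a ∷ x) = trans (cong₂ _+_ (ℚ.*-zeroˡ a) (dot-zeroˡ x)) (ℚ.+-identityˡ 0ℚ)

dot-oneˡ : (x : Vec ℚ n) → dot (replicate n 1ℚ) x ≡ sumℚ x
dot-oneˡ []      = refl
dot-oneˡ (a ∷ x) = cong₂ _+_ (ℚ.*-identityˡ a) (dot-oneˡ x)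

nonNeg-⊕ : {u v : Vec ℚ n} → NonNeg u → NonNeg v → NonNeg (u ⊕ v)
nonNeg-⊕ []       []       = []
nonNeg-⊕ (p ∷ ps) (q ∷ qs) = nonNeg+ p q ∷ nonNeg-⊕ ps qs

nonNeg-⊙ : ∀ {c} {v : Vec ℚ n} → 0ℚ ≤ℚ c → NonNeg v → NonNeg (c ⊙ v)
nonNeg-⊙ 0≤c []       = []
nonNeg-⊙ 0≤c (q ∷ qs) = nonNeg* 0≤c q ∷ nonNeg-⊙ 0≤c qs

nonNeg-0ᵥ : NonNeg (0ᵥ {n})
nonNeg-0ᵥ {zero}  = []
nonNeg-0ᵥ {suc n} = ℚ.≤-refl ∷ nonNeg-0ᵥ

nonNeg-dot : {μ c : Vec ℚ n} → NonNeg μ → NonNeg c → 0ℚ ≤ℚ dot μ c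
nonNeg-dot []       []       = ℚ.≤-refl
nonNeg-dot (p ∷ ps) (q ∷ qs) = nonNeg+ (nonNeg* p q) (nonNeg-dot ps qs)

nonNeg-sumℚ : {μ : Vec ℚ n} → NonNeg μ → 0ℚ ≤ℚ sumℚ μ
nonNeg-sumℚ []       = ℚ.≤-refl
nonNeg-sumℚ (p ∷ ps) = nonNeg+ p (nonNeg-sumℚ ps)

nonNeg-sumℚ≡0⇒≡0ᵥ : {v : Vec ℚ n} → NonNeg v → sumℚ v ≡ 0ℚ → v ≡ 0ᵥ
nonNeg-sumℚ≡0⇒≡0ᵥ []       _  = refl
nonNeg-sumℚ≡0⇒≡0ᵥ {v = a ∷ v} (p ∷ ps) Σ≡0 = cong₂ _∷_
  (nonNeg+nonNeg≡0⇒≡0 p (nonNeg-sumℚ ps) Σ≡0)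
  (nonNeg-sumℚ≡0⇒≡0ᵥ ps (nonNeg+nonNeg≡0⇒≡0 (nonNeg-sumℚ ps) p (trans (ℚ.+-comm (sumℚ v) a) Σ≡0)))

unitVector : Fin k → Vec ℚ k
unitVector zero    = 1ℚ ∷ 0ᵥ
unitVector (suc j) = 0ℚ ∷ unitVector j

lincombℚ-unitVector : (j : Fin k) (W : Vec (Vec ℚ n) k) → lincombℚ (unitVector j) W ≡ lookup W j
lincombℚ-unitVector zero    (w ∷ W) = trans (cong₂ _⊕_ (⊙-identityˡ w) (lincombℚ-zeroˡ W)) (⊕-identityʳ w)
lincombℚ-unitVector (suc j) (w ∷ W) = trans (cong₂ _⊕_ (⊙-zeroˡ w) (lincombℚ-unitVector j W)) (⊕-identityˡ _)

unitVector-stochastic : (j : Fin k) → Stochastic (unitVector j)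
unitVector-stochastic {suc k} zero =
  *≤* (ℤ.+≤+ ℕ.z≤n) ∷ nonNeg-0ᵥ , trans (cong (1ℚ +_) (sumℚ-0ᵥ {k})) (ℚ.+-identityʳ 1ℚ)
unitVector-stochastic (suc j) with unitVector-stochastic j
... | nonNeg , Σ≡1 = ℚ.≤-refl ∷ nonNeg , trans (ℚ.+-identityˡ _) Σ≡1

stochastic-mix : ∀ {α β} {λ₁ λ₂ : Vec ℚ n} → 0ℚ ≤ℚ α → 0ℚ ≤ℚ β → α + β ≡ 1ℚ →
                 Stochastic λ₁ → Stochastic λ₂ → Stochastic (α ⊙ λ₁ ⊕ β ⊙ λ₂)
stochastic-mix {α = α} {β} {λ₁} {λ₂} 0≤α 0≤β α+β≡1 (0≤λ₁ , Σλ₁≡1) (0≤λ₂ , Σλ₂≡1) =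
  nonNeg-⊕ (nonNeg-⊙ 0≤α 0≤λ₁) (nonNeg-⊙ 0≤β 0≤λ₂) , (begin
    sumℚ (α ⊙ λ₁ ⊕ β ⊙ λ₂)            ≡⟨ sumℚ-⊕ (α ⊙ λ₁) (β ⊙ λ₂) ⟩
    sumℚ (α ⊙ λ₁) + sumℚ (β ⊙ λ₂)     ≡⟨ cong₂ _+_ (sumℚ-⊙ α λ₁) (sumℚ-⊙ β λ₂) ⟩
    α * sumℚ λ₁ + β * sumℚ λ₂         ≡⟨ cong₂ (λ x y → α * x + β * y) Σλ₁≡1 Σλ₂≡1 ⟩
    α * 1ℚ + β * 1ℚ                   ≡⟨ cong₂ _+_ (ℚ.*-identityʳ α) (ℚ.*-identityʳ β) ⟩
    α + β                             ≡⟨ α+β≡1 ⟩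
    1ℚ                                ∎)
  where open ≡-Reasoning

fixedPoint⇒offset : ∀ (I N : ℚ) (z a : Vec ℚ n) → I ⊙ z ⊕ a ≡ N ⊙ z → a ≡ (N - I) ⊙ z
fixedPoint⇒offset I N []      []      _  = refl
fixedPoint⇒offset I N (x ∷ z) (b ∷ a) eq = cong₂ _∷_ b≡ (fixedPoint⇒offset I N z a (Vec.∷-injectiveʳ eq))
  where
  open ≡-Reasoning
  b≡ : b ≡ (N - I) * x
  b≡ = begin
    b                  ≡⟨ solve 3 (λ b I x → b := I :* x :+ b :- I :* x) refl b I x ⟩
    I * x + b - I * x  ≡⟨ cong (_- I * x) (Vec.∷-injectiveˡ eq) ⟩
    N * x - I * x      ≡⟨ solve 3 (λ N I x → N :* x :- I :* x := (N :- I) :* x) refl N I x ⟩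
    (N - I) * x        ∎

∣⊙∣≤ : ∀ {a S} {w : Vec ℚ n} → 0ℚ ≤ℚ a → All (λ y → ∣ y ∣ ≤ℚ S) w → All (λ y → ∣ y ∣ ≤ℚ a * S) (a ⊙ w)
∣⊙∣≤ 0≤a = Allₚ.map⁺ ∘ All.map (∣*∣≤ 0≤a)

∣⊕∣≤ : ∀ {S T} {v w : Vec ℚ n} → All (λ y → ∣ y ∣ ≤ℚ S) v → All (λ y → ∣ y ∣ ≤ℚ T) w →
       All (λ y → ∣ y ∣ ≤ℚ S + T) (v ⊕ w)
∣⊕∣≤ []       []       = []
∣⊕∣≤ {v = a ∷ _} {b ∷ _} (h ∷ hs) (g ∷ gs) = ℚ.≤-trans (ℚ.∣p+q∣≤∣p∣+∣q∣ a b) (ℚ.+-mono-≤ h g) ∷ ∣⊕∣≤ hs gs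

∣lincombℚ∣≤ : ∀ {S} {μ : Vec ℚ k} {W : Vec (Vec ℚ n) k} → NonNeg μ → All (All (λ y → ∣ y ∣ ≤ℚ S)) W →
              All (λ y → ∣ y ∣ ≤ℚ sumℚ μ * S) (lincombℚ μ W)
∣lincombℚ∣≤ {S = S} [] [] = ∣0ᵥ∣≤
  where
  ∣0ᵥ∣≤ : All (λ y → ∣ y ∣ ≤ℚ 0ℚ * S) (0ᵥ {n})
  ∣0ᵥ∣≤ {zero}  = []
  ∣0ᵥ∣≤ {suc n} = ℚ.≤-reflexive (sym (ℚ.*-zeroˡ S)) ∷ ∣0ᵥ∣≤
∣lincombℚ∣≤ {S = S} {a ∷ μ} (0≤a ∷ 0≤μ) (w≤ ∷ W≤) =
  All.map (subst (_ ≤ℚ_) (sym (ℚ.*-distribʳ-+ S a (sumℚ μ)))) (∣⊕∣≤ (∣⊙∣≤ 0≤a w≤) (∣lincombℚ∣≤ 0≤μ W≤))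

-- Stationary distributions of stochastic matrices

head-nonNeg : {v : Vec ℚ (suc n)} → NonNeg v → 0ℚ ≤ℚ head v
head-nonNeg (0≤c ∷ _) = 0≤c

-- A row of the chain watched only off state 0, where row 0 is p ∷ q and s = 1/Σq: the mass the
-- row sends to state 0 is passed on the way state 0 itself would pass it on.
censor : ℚ → Vec ℚ n → Vec ℚ (suc n) → Vec ℚ n
censor s q (c ∷ t) = t ⊕ (c * s) ⊙ q

censor-stochastic : ∀ {s} {q : Vec ℚ n} → 0ℚ ≤ℚ s → NonNeg q → s * sumℚ q ≡ 1ℚ →
                    {r : Vec ℚ (suc n)} → Stochastic r → Stochastic (censor s q r)
censor-stochastic {s = s} {q} 0≤s 0≤q s*Σq≡1 {c ∷ t} (0≤c ∷ 0≤t , c+Σt≡1) =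
  nonNeg-⊕ 0≤t (nonNeg-⊙ (nonNeg* 0≤c 0≤s) 0≤q) , Σ≡1
  where
  open ≡-Reasoning
  Σ≡1 : sumℚ (t ⊕ (c * s) ⊙ q) ≡ 1ℚ
  Σ≡1 = begin
    sumℚ (t ⊕ (c * s) ⊙ q)         ≡⟨ sumℚ-⊕ t ((c * s) ⊙ q) ⟩
    sumℚ t + sumℚ ((c * s) ⊙ q)    ≡⟨ cong (sumℚ t +_) (sumℚ-⊙ (c * s) q) ⟩
    sumℚ t + c * s * sumℚ q        ≡⟨ solve 4 (λ x c s y → x :+ c :* s :* y := c :* (s :* y) :+ x) refl (sumℚ t) c s (sumℚ q) ⟩
    c * (s * sumℚ q) + sumℚ t      ≡⟨ cong (λ y → c * y + sumℚ t) s*Σq≡1 ⟩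
    c * 1ℚ + sumℚ t                ≡⟨ cong (_+ sumℚ t) (ℚ.*-identityʳ c) ⟩
    c + sumℚ t                     ≡⟨ c+Σt≡1 ⟩
    1ℚ                             ∎

lincombℚ-censor : ∀ s (q : Vec ℚ n) (μ : Vec ℚ k) (R : Vec (Vec ℚ (suc n)) k) →
  lincombℚ μ (map (censor s q) R) ≡ lincombℚ μ (map tail R) ⊕ (dot (map head R) μ * s) ⊙ q
lincombℚ-censor s q []      []            = sym (trans (cong (0ᵥ ⊕_) (trans (cong (_⊙ q) (ℚ.*-zeroˡ s)) (⊙-zeroˡ q))) (⊕-identityˡ 0ᵥ))
lincombℚ-censor s q (a ∷ μ) ((c ∷ t) ∷ R) = begin
  a ⊙ (t ⊕ (c * s) ⊙ q) ⊕ lincombℚ μ (map (censor s q) R)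
    ≡⟨ cong₂ _⊕_ (⊙-distribˡ-⊕ a t _) (lincombℚ-censor s q μ R) ⟩
  a ⊙ t ⊕ a ⊙ (c * s) ⊙ q ⊕ (lincombℚ μ (map tail R) ⊕ (D * s) ⊙ q)
    ≡⟨ ⊕-interchange (a ⊙ t) _ _ _ ⟩
  a ⊙ t ⊕ lincombℚ μ (map tail R) ⊕ (a ⊙ (c * s) ⊙ q ⊕ (D * s) ⊙ q)
    ≡⟨ cong (a ⊙ t ⊕ lincombℚ μ (map tail R) ⊕_) (trans (cong (_⊕ (D * s) ⊙ q) (⊙-assoc a (c * s) q))
                                                        (sym (⊙-distribʳ-+ (a * (c * s)) (D * s) q))) ⟩
  a ⊙ t ⊕ lincombℚ μ (map tail R) ⊕ (a * (c * s) + D * s) ⊙ q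
    ≡⟨ cong (λ x → a ⊙ t ⊕ lincombℚ μ (map tail R) ⊕ x ⊙ q)
            (solve 4 (λ a c s D → a :* (c :* s) :+ D :* s := (c :* a :+ D) :* s) refl a c s D) ⟩
  a ⊙ t ⊕ lincombℚ μ (map tail R) ⊕ ((c * a + D) * s) ⊙ q ∎
  where
  open ≡-Reasoning
  D = dot (map head R) μ

StationaryMeasure : Vec (Vec ℚ n) n → Vec ℚ n → Set
StationaryMeasure Λ μ = NonNeg μ × 0ℚ <ℚ sumℚ μ × lincombℚ μ Λ ≡ μ

absorbing-stationary : ∀ {p} {q : Vec ℚ k} (R : Vec (Vec ℚ (suc k)) k) → p ≡ 1ℚ → q ≡ 0ᵥ →
                       StationaryMeasure ((p ∷ q) ∷ R) (unitVector zero)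
absorbing-stationary {k} R refl refl with unitVector-stochastic {suc k} zero
... | 0≤e , Σe≡1 = 0≤e , subst (0ℚ <ℚ_) (sym Σe≡1) (ℚ.positive⁻¹ 1ℚ) ,
  trans (cong₂ _⊕_ (⊙-identityˡ (1ℚ ∷ 0ᵥ)) (lincombℚ-zeroˡ R)) (⊕-identityʳ (1ℚ ∷ 0ᵥ))

-- The new mass μ₀ balances the flow into state 0, Σⱼ μⱼ Rⱼ₀, against the flow out of it, μ₀ Σq.
censored-stationary : ∀ {p s} {q : Vec ℚ n} (R : Vec (Vec ℚ (suc n)) n) → All Stochastic R →
                      0ℚ ≤ℚ s → s * sumℚ q ≡ 1ℚ → p + sumℚ q ≡ 1ℚ →
                      ∀ {μ} → StationaryMeasure (map (censor s q) R) μ →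
                      StationaryMeasure ((p ∷ q) ∷ R) (dot (map head R) μ * s ∷ μ)
censored-stationary {p = p} {s} {q} R stochR 0≤s s*Σq≡1 p+Σq≡1 {μ} (0≤μ , 0<Σμ , μΛ≡μ) =
  (0≤μ₀ ∷ 0≤μ) , ℚ.+-mono-≤-< 0≤μ₀ 0<Σμ ,
  trans (cong (μ₀ ⊙ (p ∷ q) ⊕_) (lincombℚ-∷ μ R)) (cong₂ _∷_ head≡ tail≡)
  where
  D μ₀ : ℚ
  D  = dot (map head R) μ
  μ₀ = D * s
  0≤μ₀ : 0ℚ ≤ℚ μ₀
  0≤μ₀ = nonNeg* (nonNeg-dot (Allₚ.map⁺ (All.map head-nonNeg (All.map proj₁ stochR))) 0≤μ) 0≤s
  open ≡-Reasoning
  head≡ : μ₀ * p + D ≡ μ₀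
  head≡ = begin
    μ₀ * p + D                ≡⟨ cong (μ₀ * p +_) (ℚ.*-identityʳ D) ⟨
    μ₀ * p + D * 1ℚ           ≡⟨ cong (λ x → μ₀ * p + D * x) s*Σq≡1 ⟨
    D * s * p + D * (s * sumℚ q) ≡⟨ solve 4 (λ D s p σ → D :* s :* p :+ D :* (s :* σ) := D :* s :* (p :+ σ)) refl D s p (sumℚ q) ⟩
    μ₀ * (p + sumℚ q)         ≡⟨ cong (μ₀ *_) p+Σq≡1 ⟩
    μ₀ * 1ℚ                   ≡⟨ ℚ.*-identityʳ μ₀ ⟩
    μ₀                        ∎
  tail≡ : μ₀ ⊙ q ⊕ lincombℚ μ (map tail R) ≡ μ
  tail≡ = begin
    μ₀ ⊙ q ⊕ lincombℚ μ (map tail R)  ≡⟨ ⊕-comm (μ₀ ⊙ q) _ ⟩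
    lincombℚ μ (map tail R) ⊕ μ₀ ⊙ q  ≡⟨ lincombℚ-censor s q μ R ⟨
    lincombℚ μ (map (censor s q) R)   ≡⟨ μΛ≡μ ⟩
    μ                                 ∎

stationaryMeasure : ∀ k (Λ : Vec (Vec ℚ (suc k)) (suc k)) → All Stochastic Λ →
                    ∃ (StationaryMeasure Λ)
stationaryMeasure zero ((p ∷ []) ∷ []) ((_ , p+0≡1) ∷ []) =
  unitVector zero , absorbing-stationary [] (trans (sym (ℚ.+-identityʳ p)) p+0≡1) refl
stationaryMeasure (suc k) ((p ∷ q) ∷ R) ((_ ∷ 0≤q , p+Σq≡1) ∷ stochR) with ℚ.<-cmp 0ℚ (sumℚ q)
... | tri> _ _ Σq<0 = ⊥-elim (ℚ.<-irrefl refl (ℚ.<-≤-trans Σq<0 (nonNeg-sumℚ 0≤q)))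
... | tri≈ _ 0≡Σq _ = unitVector zero , absorbing-stationary R p≡1 q≡0
  where
  q≡0 : q ≡ 0ᵥ
  q≡0 = nonNeg-sumℚ≡0⇒≡0ᵥ 0≤q (sym 0≡Σq)
  p≡1 : p ≡ 1ℚ
  p≡1 = trans (sym (ℚ.+-identityʳ p)) (trans (cong (p +_) 0≡Σq) p+Σq≡1)
... | tri< 0<Σq _ _ = _ , censored-stationary R stochR 0≤c c*Σq≡1 p+Σq≡1 (proj₂ reduced)
  where
  instance
    Σq≢0 : NonZero (sumℚ q)
    Σq≢0 = ℚ.pos⇒nonZero (sumℚ q) {{positive 0<Σq}}
  c : ℚ
  c = 1/ sumℚ q
  0≤c : 0ℚ ≤ℚ c
  0≤c = 1/pos-nonNeg 0<Σq
  c*Σq≡1 : c * sumℚ q ≡ 1ℚ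
  c*Σq≡1 = ℚ.*-inverseˡ (sumℚ q)
  reduced : ∃ (StationaryMeasure (map (censor c q) R))
  reduced = stationaryMeasure k (map (censor c q) R)
              (Allₚ.map⁺ (All.map (censor-stochastic 0≤c 0≤q c*Σq≡1) stochR))

stationaryDistribution : ∀ k (Λ : Vec (Vec ℚ (suc k)) (suc k)) → All Stochastic Λ →
                         ∃ λ μ → Stochastic μ × lincombℚ μ Λ ≡ μ
stationaryDistribution k Λ stochΛ with stationaryMeasure k Λ stochΛ
... | μ , 0≤μ , 0<Σμ , μΛ≡μ = c ⊙ μ , (nonNeg-⊙ (1/pos-nonNeg 0<Σμ) 0≤μ , Σ≡1) ,
                              trans (lincombℚ-⊙ c μ Λ) (cong (c ⊙_) μΛ≡μ)
  where
  instance
    Σμ≢0 : NonZero (sumℚ μ)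
    Σμ≢0 = ℚ.pos⇒nonZero (sumℚ μ) {{positive 0<Σμ}}
  c : ℚ
  c = 1/ sumℚ μ
  Σ≡1 : sumℚ (c ⊙ μ) ≡ 1ℚ
  Σ≡1 = trans (sumℚ-⊙ c μ) (ℚ.*-inverseˡ (sumℚ μ))

stationary-fixedPoint : ∀ (I N : ℚ) (a : Vec ℚ n) (W : Vec (Vec ℚ n) k) (Λ : Vec (Vec ℚ k) k) {μ} →
  map (λ r → N ⊙ lincombℚ r W) Λ ≡ map (λ w → I ⊙ w ⊕ a) W →
  Stochastic μ → lincombℚ μ Λ ≡ μ → I ⊙ lincombℚ μ W ⊕ a ≡ N ⊙ lincombℚ μ W
stationary-fixedPoint I N a W Λ {μ} rows≡ (_ , Σμ≡1) μΛ≡μ = begin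
  I ⊙ lincombℚ μ W ⊕ a                                   ≡⟨ cong (I ⊙ lincombℚ μ W ⊕_) Σμ⊙a≡a ⟨
  I ⊙ lincombℚ μ W ⊕ sumℚ μ ⊙ a                          ≡⟨ lincombℚ-affine I a μ W ⟨
  lincombℚ μ (map (λ w → I ⊙ w ⊕ a) W)                   ≡⟨ cong (lincombℚ μ) rows≡ ⟨
  lincombℚ μ (map (λ r → N ⊙ lincombℚ r W) Λ)            ≡⟨ cong (lincombℚ μ) (Vec.map-∘ (N ⊙_) (λ r → lincombℚ r W) Λ) ⟩
  lincombℚ μ (map (N ⊙_) (map (λ r → lincombℚ r W) Λ))  ≡⟨ lincombℚ-map-⊙ N μ _ ⟩
  N ⊙ lincombℚ μ (map (λ r → lincombℚ r W) Λ)           ≡⟨ cong (N ⊙_) (lincombℚ-assoc μ Λ W) ⟩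
  N ⊙ lincombℚ (lincombℚ μ Λ) W                         ≡⟨ cong (λ ν → N ⊙ lincombℚ ν W) μΛ≡μ ⟩
  N ⊙ lincombℚ μ W                                       ∎
  where
  open ≡-Reasoning
  Σμ⊙a≡a : sumℚ μ ⊙ a ≡ a
  Σμ⊙a≡a = trans (cong (_⊙ a) Σμ≡1) (⊙-identityˡ a)

-- Fourier–Motzkin elimination

Constraint : ℕ → Set
Constraint k = Vec ℚ k × ℚ

Satisfies : Constraint k → Vec ℚ k → Set
Satisfies (a , b) x = dot a x ≤ℚ b

System : ℕ → Set
System k = List (Constraint k)

Solves : System k → Vec ℚ k → Set
Solves S x = ListAll.All (λ c → Satisfies c x) S

Feasible : System k → Set
Feasible S = ∃ (Solves S)

satisfies? : (c : Constraint k) (x : Vec ℚ k) → Dec (Satisfies c x)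
satisfies? (a , b) x = dot a x ℚ.≤? b

prepend : ℚ → Constraint k → Constraint (suc k)
prepend c (a , b) = c ∷ a , b

satisfies-prepend0 : ∀ (c : Constraint k) {x₀ x} → Satisfies (prepend 0ℚ c) (x₀ ∷ x) ⇔ Satisfies c x
satisfies-prepend0 (a , b) {x₀} {x} = ≤-shift⇔ 0ℚ
  (solve 2 (λ x₀ d → con 0ℚ :* x₀ :+ d :+ con 0ℚ := d) refl x₀ (dot a x)) (ℚ.+-identityʳ b)

satisfies-prepend-cong : ∀ {h h′} (c : Constraint k) {x} → h ≡ h′ →
                         Satisfies (prepend h c) x ⇔ Satisfies (prepend h′ c) x
satisfies-prepend-cong c refl = ⇔.refl

satisfies-scale : ∀ {c} → 0ℚ <ℚ c → ∀ (a : Vec ℚ k) b {x} → Satisfies (c ⊙ a , c * b) x ⇔ Satisfies (a , b) x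
satisfies-scale {c = c} 0<c a b {x} = mk⇔
  (λ h → ℚ.*-cancelˡ-≤-pos c {{positive 0<c}} (subst (_≤ℚ c * b) (dot-⊙ˡ c a x) h))
  (λ h → subst (_≤ℚ c * b) (sym (dot-⊙ˡ c a x)) (ℚ.*-monoˡ-≤-nonNeg c {{ℚ.pos⇒nonNeg c {{positive 0<c}}}} h))

upperBound lowerBound : Constraint k → Vec ℚ k → ℚ
upperBound (u , β) x = β - dot u x
lowerBound (l , γ) x = dot l x - γ

satisfies-upper : ∀ (c : Constraint k) {x₀ x} → Satisfies (prepend 1ℚ c) (x₀ ∷ x) ⇔ (x₀ ≤ℚ upperBound c x)
satisfies-upper (u , β) {x₀} {x} = ≤-shift⇔ (- dot u x)
  (solve 2 (λ x₀ d → con 1ℚ :* x₀ :+ d :- d := x₀) refl x₀ (dot u x)) refl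

satisfies-lower : ∀ (c : Constraint k) {x₀ x} → Satisfies (prepend (- 1ℚ) c) (x₀ ∷ x) ⇔ (lowerBound c x ≤ℚ x₀)
satisfies-lower (l , γ) {x₀} {x} = ≤-shift⇔ (x₀ - γ)
  (solve 3 (λ x₀ d γ → :- con 1ℚ :* x₀ :+ d :+ (x₀ :- γ) := d :- γ) refl x₀ (dot l x) γ)
  (solve 2 (λ γ x₀ → γ :+ (x₀ :- γ) := x₀) refl γ x₀)

combine : Constraint k → Constraint k → Constraint k
combine (u , β) (l , γ) = u ⊕ l , β + γ

satisfies-combine : ∀ (cᵤ cₗ : Constraint k) {x} →
                    Satisfies (combine cᵤ cₗ) x ⇔ (lowerBound cₗ x ≤ℚ upperBound cᵤ x)
satisfies-combine (u , β) (l , γ) {x} = ≤-shift⇔ (- dot u x - γ)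
  (trans (cong (_+ (- dot u x - γ)) (dot-⊕ˡ u l x))
         (solve 3 (λ du dl γ → du :+ dl :+ (:- du :- γ) := dl :- γ) refl (dot u x) (dot l x) γ))
  (solve 3 (λ β γ du → β :+ γ :+ (:- du :- γ) := β :- du) refl β γ (dot u x))

data Bound (k : ℕ) : Set where
  upper lower free : Constraint k → Bound k

BoundHolds : ℚ → Vec ℚ k → Bound k → Set
BoundHolds x₀ x (upper c) = x₀ ≤ℚ upperBound c x
BoundHolds x₀ x (lower c) = lowerBound c x ≤ℚ x₀
BoundHolds x₀ x (free c)  = Satisfies c x

classify : Constraint (suc k) → Bound k
classify (c ∷ a , b) with ℚ.<-cmp 0ℚ c
... | tri< 0<c _ _ = upper (1/ c ⊙ a , 1/ c * b)
  where instance _ = ℚ.pos⇒nonZero c {{positive 0<c}}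
... | tri≈ _ _ _   = free (a , b)
... | tri> _ _ c<0 = lower (1/ (- c) ⊙ a , 1/ (- c) * b)
  where instance _ = ℚ.pos⇒nonZero (- c) {{positive (ℚ.neg-antimono-< c<0)}}

classify-correct : ∀ (c : Constraint (suc k)) {x₀ x} → Satisfies c (x₀ ∷ x) ⇔ BoundHolds x₀ x (classify c)
classify-correct (c ∷ a , b) {x₀} {x} with ℚ.<-cmp 0ℚ c
... | tri< 0<c _ _ = ⇔.trans (⇔.sym (satisfies-scale 0<c⁻¹ (c ∷ a) b {x₀ ∷ x}))
                      (⇔.trans (satisfies-prepend-cong (1/ c ⊙ a , 1/ c * b) {x₀ ∷ x} (ℚ.*-inverseˡ c))
                               (satisfies-upper (1/ c ⊙ a , 1/ c * b)))
  where
  instance _ = ℚ.pos⇒nonZero c {{positive 0<c}}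
  0<c⁻¹ : 0ℚ <ℚ 1/ c
  0<c⁻¹ = ℚ.positive⁻¹ _ {{ℚ.1/pos⇒pos c {{positive 0<c}}}}
... | tri≈ _ refl _ = satisfies-prepend0 (a , b) {x₀}
... | tri> _ _ c<0 = ⇔.trans (⇔.sym (satisfies-scale 0<c⁻¹ (c ∷ a) b {x₀ ∷ x}))
                      (⇔.trans (satisfies-prepend-cong (1/ (- c) ⊙ a , 1/ (- c) * b) {x₀ ∷ x} c⁻¹*c≡-1)
                               (satisfies-lower (1/ (- c) ⊙ a , 1/ (- c) * b)))
  where
  0<-c : 0ℚ <ℚ - c
  0<-c = ℚ.neg-antimono-< c<0
  instance _ = ℚ.pos⇒nonZero (- c) {{positive 0<-c}}
  0<c⁻¹ : 0ℚ <ℚ 1/ (- c)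
  0<c⁻¹ = ℚ.positive⁻¹ _ {{ℚ.1/pos⇒pos (- c) {{positive 0<-c}}}}
  c⁻¹*c≡-1 : 1/ (- c) * c ≡ - 1ℚ
  c⁻¹*c≡-1 = trans (solve 2 (λ s c → s :* c := :- (s :* (:- c))) refl (1/ (- c)) c)
                   (cong -_ (ℚ.*-inverseˡ (- c)))

uppers lowers frees : System (suc k) → System k
uppers []      = []
uppers (c ∷ S) with classify c
... | upper cᵤ = cᵤ ∷ uppers S
... | _        = uppers S
lowers []      = []
lowers (c ∷ S) with classify c
... | lower cₗ = cₗ ∷ lowers S
... | _        = lowers S
frees []       = []
frees (c ∷ S) with classify c
... | free c′ = c′ ∷ frees S
... | _       = frees S

module _ {x₀ : ℚ} {x : Vec ℚ k} where

  PartitionHolds : System (suc k) → Set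
  PartitionHolds S = ListAll.All (λ c → x₀ ≤ℚ upperBound c x) (uppers S) ×
                     ListAll.All (λ c → lowerBound c x ≤ℚ x₀) (lowers S) ×
                     Solves (frees S) x

  partitionHolds⁺ : ∀ S → Solves S (x₀ ∷ x) → PartitionHolds S
  partitionHolds⁺ []      []       = [] , [] , []
  partitionHolds⁺ (c ∷ S) (h ∷ hs) with classify c | Equivalence.to (classify-correct c) h
  ... | upper _ | h′ = map₁ (h′ ∷_) (partitionHolds⁺ S hs)
  ... | lower _ | h′ = map₂ (map₁ (h′ ∷_)) (partitionHolds⁺ S hs)
  ... | free _  | h′ = map₂ (map₂ (h′ ∷_)) (partitionHolds⁺ S hs)

  partitionHolds⁻ : ∀ S → PartitionHolds S → Solves S (x₀ ∷ x)
  partitionHolds⁻ []      _     = []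
  partitionHolds⁻ (c ∷ S) holds with classify c | classify-correct c {x₀} {x}
  partitionHolds⁻ (c ∷ S) (h ∷ us , ls , fs) | upper _ | c⇔ = Equivalence.from c⇔ h ∷ partitionHolds⁻ S (us , ls , fs)
  partitionHolds⁻ (c ∷ S) (us , h ∷ ls , fs) | lower _ | c⇔ = Equivalence.from c⇔ h ∷ partitionHolds⁻ S (us , ls , fs)
  partitionHolds⁻ (c ∷ S) (us , ls , h ∷ fs) | free _  | c⇔ = Equivalence.from c⇔ h ∷ partitionHolds⁻ S (us , ls , fs)

module _ {A B C : Set} {P : C → Set} (f : A → B → C) where

  all-cartesianProductWith⁺ : ∀ xs ys → ListAll.All (λ a → ListAll.All (λ b → P (f a b)) ys) xs →
                              ListAll.All P (cartesianProductWith f xs ys)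
  all-cartesianProductWith⁺ []       ys []       = []
  all-cartesianProductWith⁺ (a ∷ xs) ys (h ∷ hs) =
    ListAllₚ.++⁺ (ListAllₚ.map⁺ h) (all-cartesianProductWith⁺ xs ys hs)

  all-cartesianProductWith⁻ : ∀ xs ys → ListAll.All P (cartesianProductWith f xs ys) →
                              ListAll.All (λ a → ListAll.All (λ b → P (f a b)) ys) xs
  all-cartesianProductWith⁻ []       ys _ = []
  all-cartesianProductWith⁻ (a ∷ xs) ys h with ListAllₚ.++⁻ (List.map (f a) ys) h
  ... | ha , hs = ListAllₚ.map⁻ ha ∷ all-cartesianProductWith⁻ xs ys hs

between : (lo hi : List ℚ) → ListAll.All (λ h → ListAll.All (_≤ℚ h) lo) hi →
          ∃ λ x → ListAll.All (_≤ℚ x) lo × ListAll.All (x ≤ℚ_) hi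
between []       hi _ = Extrema.min 0ℚ hi , [] , Extrema.min≤xs 0ℚ hi
between (l ∷ ls) hi lo≤hi = Extrema.max l ls , Extrema.⊥≤max l ls ∷ Extrema.xs≤max l ls ,
  ListAll.map (λ { (l≤h ∷ ls≤h) → Extrema.max≤v⁺ l≤h ls≤h }) lo≤hi

eliminate : System (suc k) → System k
eliminate S = frees S ++ cartesianProductWith combine (uppers S) (lowers S)

eliminate-sound : ∀ (S : System (suc k)) {x₀ x} → Solves S (x₀ ∷ x) → Solves (eliminate S) x
eliminate-sound S {x₀} {x} sol with partitionHolds⁺ S sol
... | x₀≤us , ls≤x₀ , fs = ListAllₚ.++⁺ fs (all-cartesianProductWith⁺ combine _ _
  (ListAll.map (λ {cᵤ} x₀≤u → ListAll.map (λ {cₗ} l≤x₀ →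
    Equivalence.from (satisfies-combine cᵤ cₗ) (ℚ.≤-trans l≤x₀ x₀≤u)) ls≤x₀) x₀≤us))

-- Each combined constraint puts one lower bound below one upper bound, so x₀ fits between all of them.
eliminate-complete : ∀ (S : System (suc k)) {x} → Solves (eliminate S) x → ∃ λ x₀ → Solves S (x₀ ∷ x)
eliminate-complete S {x} sol = x₀ , partitionHolds⁻ S (x₀≤us , ls≤x₀ , proj₁ split)
  where
  us ls : List ℚ
  us = List.map (λ c → upperBound c x) (uppers S)
  ls = List.map (λ c → lowerBound c x) (lowers S)
  split = ListAllₚ.++⁻ (frees S) sol
  ls≤us : ListAll.All (λ u → ListAll.All (_≤ℚ u) ls) us
  ls≤us = ListAllₚ.map⁺ (ListAll.map (λ {cᵤ} h → ListAllₚ.map⁺ (ListAll.map (λ {cₗ} → Equivalence.to (satisfies-combine cᵤ cₗ)) h))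
                      (all-cartesianProductWith⁻ combine (uppers S) (lowers S) (proj₂ split)))
  chosen : ∃ λ x₀ → ListAll.All (_≤ℚ x₀) ls × ListAll.All (x₀ ≤ℚ_) us
  chosen = between ls us ls≤us
  x₀ : ℚ
  x₀ = proj₁ chosen
  x₀≤us : ListAll.All (λ c → x₀ ≤ℚ upperBound c x) (uppers S)
  x₀≤us = ListAllₚ.map⁻ (proj₂ (proj₂ chosen))
  ls≤x₀ : ListAll.All (λ c → lowerBound c x ≤ℚ x₀) (lowers S)
  ls≤x₀ = ListAllₚ.map⁻ (proj₁ (proj₂ chosen))

feasible? : ∀ k (S : System k) → Dec (Feasible S)
feasible? zero    S = map′ ([] ,_) (λ { ([] , sol) → sol }) (ListAll.all? (λ c → satisfies? c []) S)
feasible? (suc k) S = map′ extend restrict (feasible? k (eliminate S))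
  where
  extend : Feasible (eliminate S) → Feasible S
  extend (x , sol) = Product.map (_∷ x) (λ sol′ → sol′) (eliminate-complete S {x} sol)
  restrict : Feasible S → Feasible (eliminate S)
  restrict (x₀ ∷ x , sol) = x , eliminate-sound S {x₀} {x} sol

-- Convex combinations as linear systems

equation : Vec ℚ k → ℚ → System k
equation a b = (a , b) ∷ ((- 1ℚ) ⊙ a , - b) ∷ []

solves-equation : ∀ (a : Vec ℚ k) b x → Solves (equation a b) x ⇔ (dot a x ≡ b)
solves-equation a b x = mk⇔
  (λ { (ax≤b ∷ -ax≤-b ∷ []) → ℚ.≤-antisym ax≤b (Equivalence.to negate⇔ (subst (_≤ℚ - b) -ax≡ -ax≤-b)) })
  (λ ax≡b → ℚ.≤-reflexive ax≡b ∷ subst (_≤ℚ - b) (sym -ax≡) (Equivalence.from negate⇔ (ℚ.≤-reflexive (sym ax≡b))) ∷ [])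
  where
  -ax≡ : dot ((- 1ℚ) ⊙ a) x ≡ - 1ℚ * dot a x
  -ax≡ = dot-⊙ˡ (- 1ℚ) a x
  negate⇔ : (- 1ℚ * dot a x ≤ℚ - b) ⇔ (b ≤ℚ dot a x)
  negate⇔ = ≤-shift⇔ (dot a x + b) (solve 2 (λ d b → :- con 1ℚ :* d :+ (d :+ b) := b) refl (dot a x) b)
                                   (solve 2 (λ d b → :- b :+ (d :+ b) := d) refl (dot a x) b)

lincombEquations : ℚ → Vec (Vec ℚ n) m → Vec ℚ n → System m
lincombEquations T W []       = []
lincombEquations T W (y ∷ ys) = equation (T ⊙ map head W) y ++ lincombEquations T (map tail W) ys

solves-lincombEquations : ∀ T (W : Vec (Vec ℚ n) m) y μ → Solves (lincombEquations T W y) μ ⇔ (T ⊙ lincombℚ μ W ≡ y)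
solves-lincombEquations T W []       μ = mk⇔ (λ _ → empty (T ⊙ lincombℚ μ W)) (λ _ → [])
  where
  empty : (v : Vec ℚ 0) → v ≡ []
  empty [] = refl
solves-lincombEquations T W (y ∷ ys) μ = mk⇔
  (λ sol → trans split≡ (cong₂ _∷_ (trans (sym (dot-⊙ˡ T (map head W) μ))
                                           (Equivalence.to (solves-equation _ y μ) (ListAllₚ.++⁻ˡ _ sol)))
                                    (Equivalence.to (solves-lincombEquations T (map tail W) ys μ) (ListAllₚ.++⁻ʳ _ sol))))
  (λ eq → let eq′ = trans (sym split≡) eq in
    ListAllₚ.++⁺ (Equivalence.from (solves-equation _ y μ) (trans (dot-⊙ˡ T (map head W) μ) (Vec.∷-injectiveˡ eq′)))
                 (Equivalence.from (solves-lincombEquations T (map tail W) ys μ) (Vec.∷-injectiveʳ eq′)))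
  where
  split≡ : T ⊙ lincombℚ μ W ≡ T * dot (map head W) μ ∷ T ⊙ lincombℚ μ (map tail W)
  split≡ = cong (T ⊙_) (lincombℚ-∷ μ W)

solves-prepend0 : ∀ (S : System k) x₀ x → Solves (List.map (prepend 0ℚ) S) (x₀ ∷ x) ⇔ Solves S x
solves-prepend0 S x₀ x = mk⇔
  (λ sol → ListAll.map (λ {c} → Equivalence.to (satisfies-prepend0 c {x₀} {x})) (ListAllₚ.map⁻ sol))
  (λ sol → ListAllₚ.map⁺ (ListAll.map (λ {c} → Equivalence.from (satisfies-prepend0 c {x₀} {x})) sol))

nonNegativity : ∀ k → System k
nonNegativity zero    = []
nonNegativity (suc k) = ((- 1ℚ) ∷ 0ᵥ , 0ℚ) ∷ List.map (prepend 0ℚ) (nonNegativity k)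

solves-nonNegativity : ∀ k (x : Vec ℚ k) → Solves (nonNegativity k) x ⇔ NonNeg x
solves-nonNegativity zero    []       = mk⇔ (λ _ → []) (λ _ → [])
solves-nonNegativity (suc k) (x₀ ∷ x) = mk⇔
  (λ { (h ∷ hs) → Equivalence.to head⇔ h ∷ Equivalence.to tail⇔ hs })
  (λ { (h ∷ hs) → Equivalence.from head⇔ h ∷ Equivalence.from tail⇔ hs })
  where
  head⇔ : Satisfies ((- 1ℚ) ∷ 0ᵥ , 0ℚ) (x₀ ∷ x) ⇔ (0ℚ ≤ℚ x₀)
  head⇔ = ≤-shift⇔ x₀ (trans (cong (λ d → - 1ℚ * x₀ + d + x₀) (dot-zeroˡ x))
                             (solve 1 (λ x₀ → :- con 1ℚ :* x₀ :+ con 0ℚ :+ x₀ := con 0ℚ) refl x₀))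
                      (ℚ.+-identityˡ x₀)
  tail⇔ : Solves (List.map (prepend 0ℚ) (nonNegativity k)) (x₀ ∷ x) ⇔ NonNeg x
  tail⇔ = ⇔.trans (solves-prepend0 (nonNegativity k) x₀ x) (solves-nonNegativity k x)

convexCombinationSystem : ℚ → Vec (Vec ℚ n) m → Vec ℚ n → System m
convexCombinationSystem {m = m} T W y =
  nonNegativity m ++ equation (replicate m 1ℚ) 1ℚ ++ lincombEquations T W y

solves-convexCombinationSystem : ∀ T (W : Vec (Vec ℚ n) m) y μ →
  Solves (convexCombinationSystem T W y) μ ⇔ (Stochastic μ × T ⊙ lincombℚ μ W ≡ y)
solves-convexCombinationSystem {m = m} T W y μ = mk⇔
  (λ sol → let (nonNeg , rest) = ListAllₚ.++⁻ (nonNegativity m) sol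
               (normalised , eqs) = ListAllₚ.++⁻ (equation (replicate m 1ℚ) 1ℚ) rest in
    (Equivalence.to (solves-nonNegativity m μ) nonNeg ,
     trans (sym (dot-oneˡ μ)) (Equivalence.to (solves-equation (replicate m 1ℚ) 1ℚ μ) normalised)) ,
    Equivalence.to (solves-lincombEquations T W y μ) eqs)
  (λ { ((0≤μ , Σμ≡1) , eq) →
    ListAllₚ.++⁺ (Equivalence.from (solves-nonNegativity m μ) 0≤μ)
      (ListAllₚ.++⁺ (Equivalence.from (solves-equation (replicate m 1ℚ) 1ℚ μ) (trans (dot-oneˡ μ) Σμ≡1))
                    (Equivalence.from (solves-lincombEquations T W y μ) eq)) })

≤-sum : (xs : Vec ℕ n) → All (_≤ sum xs) xs
≤-sum []       = []
≤-sum (x ∷ xs) = ℕ.m≤m+n x _ ∷ All.map (λ h → ℕ.≤-trans h (ℕ.m≤n+m _ x)) (≤-sum xs)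

entryBound : Vec (ℤ^ n) m → ℕ
entryBound V = sum (map (λ v → sum (map ℤ.∣_∣ v)) V)

entry≤entryBound : (V : Vec (ℤ^ n) m) → All (All (λ c → ℤ.∣ c ∣ ≤ entryBound V)) V
entry≤entryBound V = All.map (λ {v} v≤ → All.map (λ c≤ → ℕ.≤-trans c≤ v≤) (Allₚ.map⁻ (≤-sum (map ℤ.∣_∣ v))))
                             (Allₚ.map⁻ (≤-sum (map (λ v → sum (map ℤ.∣_∣ v)) V)))

module _ {d k : ℕ} (V : Vec (ℤ^ d) (suc k)) where

  private
    P : LatticePolytope d
    P = polytope k V
    W : Vec (ℚ^ d) (suc k)
    W = map embed V

  ∈dilate⁺ : ∀ t {λs} → Stochastic λs → InDilate t P (ℕtoℚ t ⊙ lincombℚ λs W)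
  ∈dilate⁺ t {λs} (0≤λs , Σλs≡1) =
    lincomb λs V , (λs , 0≤λs , Σλs≡1 , refl) , cong (ℕtoℚ t ⊙_) (sym (lincomb≡lincombℚ λs V))

  ∈dilate⁻ : ∀ {t x} → InDilate t P x → ∃ λ λs → Stochastic λs × x ≡ ℕtoℚ t ⊙ lincombℚ λs W
  ∈dilate⁻ {t} (_ , (λs , 0≤λs , Σλs≡1 , refl) , refl) =
    λs , (0≤λs , Σλs≡1) , cong (ℕtoℚ t ⊙_) (lincomb≡lincombℚ λs V)

  vertex∈dilate : ∀ t (j : Fin (suc k)) → InDilate t P (ℕtoℚ t ⊙ lookup W j)
  vertex∈dilate t j = subst (λ v → InDilate t P (ℕtoℚ t ⊙ v)) (lincombℚ-unitVector j W)
                            (∈dilate⁺ t (unitVector-stochastic j))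

  dilate-+ : ∀ s t {y z} → 1 ≤ s ℕ.+ t → InDilate s P y → InDilate t P z → InDilate (s ℕ.+ t) P (y ⊕ z)
  dilate-+ s t 1≤s+t y∈sP z∈tP with ∈dilate⁻ {s} y∈sP | ∈dilate⁻ {t} z∈tP
  ... | λ₁ , stoch₁ , refl | λ₂ , stoch₂ , refl =
    subst (InDilate (s ℕ.+ t) P) combination≡ (∈dilate⁺ (s ℕ.+ t) (stochastic-mix 0≤α 0≤β α+β≡1 stoch₁ stoch₂))
    where
    S T U : ℚ
    S = ℕtoℚ s
    T = ℕtoℚ t
    U = ℕtoℚ (s ℕ.+ t)
    0<U : 0ℚ <ℚ U
    0<U = ℕtoℚ-pos 1≤s+t
    instance
      U≢0 : NonZero U
      U≢0 = ℚ.pos⇒nonZero U {{positive 0<U}}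
    α β : ℚ
    α = S * 1/ U
    β = T * 1/ U
    0≤α : 0ℚ ≤ℚ α
    0≤α = nonNeg* (ℕtoℚ-nonNeg s) (1/pos-nonNeg 0<U)
    0≤β : 0ℚ ≤ℚ β
    0≤β = nonNeg* (ℕtoℚ-nonNeg t) (1/pos-nonNeg 0<U)
    α+β≡1 : α + β ≡ 1ℚ
    α+β≡1 = begin
      S * 1/ U + T * 1/ U  ≡⟨ ℚ.*-distribʳ-+ (1/ U) S T ⟨
      (S + T) * 1/ U       ≡⟨ cong (_* 1/ U) (ℕtoℚ-+ s t) ⟨
      U * 1/ U             ≡⟨ ℚ.*-inverseʳ U ⟩
      1ℚ                   ∎
      where open ≡-Reasoning
    combination≡ : U ⊙ lincombℚ (α ⊙ λ₁ ⊕ β ⊙ λ₂) W ≡ S ⊙ lincombℚ λ₁ W ⊕ T ⊙ lincombℚ λ₂ W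
    combination≡ = trans (lincombℚ-mix U α β λ₁ λ₂ W)
      (cong₂ (λ x y → x ⊙ lincombℚ λ₁ W ⊕ y ⊙ lincombℚ λ₂ W) (p*[q*1/p]≡q U S) (p*[q*1/p]≡q U T))

  translateInside⁺ : ∀ {i n} (a : ℤ^ d) → 1 ≤ n → i ≤ n →
                     InDilate (n ∸ i) P (embed a) → TranslateInside i a n P
  translateInside⁺ {i} {n} a 1≤n i≤n a∈[n-i]P _ (y , y∈iP , refl) =
    subst (λ m → InDilate m P (y ⊕ embed a)) (ℕ.m+[n∸m]≡n i≤n)
          (dilate-+ i (n ∸ i) (subst (1 ≤_) (sym (ℕ.m+[n∸m]≡n i≤n)) 1≤n) y∈iP a∈[n-i]P)

  translateInside⁻ : ∀ {i n} (a : ℤ^ d) → i ≤ n →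
                     TranslateInside i a n P → InDilate (n ∸ i) P (embed a)
  translateInside⁻ {i} {n} a i≤n iP+a⊆nP =
    subst (InDilate (n ∸ i) P) (sym a≡[n-i]z) (∈dilate⁺ (n ∸ i) stochμ)
    where
    I N : ℚ
    I = ℕtoℚ i
    N = ℕtoℚ n
    image : ∀ j → ∃ λ λs → Stochastic λs × I ⊙ lookup W j ⊕ embed a ≡ N ⊙ lincombℚ λs W
    image j = ∈dilate⁻ {n} (iP+a⊆nP _ (_ , vertex∈dilate i j , refl))
    Λ : Vec (Vec ℚ (suc k)) (suc k)
    Λ = tabulate (λ j → proj₁ (image j))
    rows≡ : map (λ r → N ⊙ lincombℚ r W) Λ ≡ map (λ w → I ⊙ w ⊕ embed a) W
    rows≡ = begin
      map (λ r → N ⊙ lincombℚ r W) Λ                 ≡⟨ Vec.tabulate-∘ (λ r → N ⊙ lincombℚ r W) (λ j → proj₁ (image j)) ⟨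
      tabulate (λ j → N ⊙ lincombℚ (proj₁ (image j)) W) ≡⟨ Vec.tabulate-cong (λ j → sym (proj₂ (proj₂ (image j)))) ⟩
      tabulate (λ j → I ⊙ lookup W j ⊕ embed a)      ≡⟨ Vec.tabulate-∘ (λ w → I ⊙ w ⊕ embed a) (lookup W) ⟩
      map (λ w → I ⊙ w ⊕ embed a) (tabulate (lookup W)) ≡⟨ cong (map _) (Vec.tabulate∘lookup W) ⟩
      map (λ w → I ⊙ w ⊕ embed a) W                  ∎
      where open ≡-Reasoning
    stationary = stationaryDistribution k Λ (Allₚ.tabulate⁺ (λ j → proj₁ (proj₂ (image j))))
    μ = proj₁ stationary
    stochμ = proj₁ (proj₂ stationary)
    a≡[n-i]z : embed a ≡ ℕtoℚ (n ∸ i) ⊙ lincombℚ μ W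
    a≡[n-i]z = trans
      (fixedPoint⇒offset I N (lincombℚ μ W) (embed a)
        (stationary-fixedPoint I N (embed a) W Λ rows≡ stochμ (proj₂ (proj₂ stationary))))
      (cong (_⊙ lincombℚ μ W) (sym (ℕtoℚ-∸ i≤n)))

  inDilate? : ∀ t x → Dec (InDilate t P x)
  inDilate? t x = map′
    (λ { (μ , sol) → let (stochμ , eq) = Equivalence.to (solves-convexCombinationSystem (ℕtoℚ t) W x μ) sol in
                       subst (InDilate t P) eq (∈dilate⁺ t stochμ) })
    (λ x∈tP → let (μ , stochμ , eq) = ∈dilate⁻ {t} x∈tP in
                μ , Equivalence.from (solves-convexCombinationSystem (ℕtoℚ t) W x μ) (stochμ , sym eq))
    (feasible? (suc k) (convexCombinationSystem (ℕtoℚ t) W x))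

  inDilate-bounded : ∀ t (z : ℤ^ d) → InDilate t P (embed z) → All (λ c → ℤ.∣ c ∣ ≤ t ℕ.* entryBound V) z
  inDilate-bounded t z z∈tP with ∈dilate⁻ {t} z∈tP
  ... | μ , (0≤μ , Σμ≡1) , z≡ =
    All.map (λ {c} → Equivalence.to (∣ℤtoℚ∣≤ℕtoℚ⇔ c (t ℕ.* entryBound V)))
            (Allₚ.map⁻ (subst (All (λ y → ∣ y ∣ ≤ℚ ℕtoℚ (t ℕ.* entryBound V))) (sym z≡) scaled))
    where
    B : ℚ
    B = ℕtoℚ (entryBound V)
    vertices≤ : All (All (λ y → ∣ y ∣ ≤ℚ B)) W
    vertices≤ = Allₚ.map⁺ (All.map (λ v≤ → Allₚ.map⁺ (All.map (λ {c} → Equivalence.from (∣ℤtoℚ∣≤ℕtoℚ⇔ c (entryBound V))) v≤))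
                                   (entry≤entryBound V))
    point≤ : All (λ y → ∣ y ∣ ≤ℚ B) (lincombℚ μ W)
    point≤ = All.map (subst (_ ≤ℚ_) (trans (cong (_* B) Σμ≡1) (ℚ.*-identityˡ B))) (∣lincombℚ∣≤ 0≤μ vertices≤)
    scaled : All (λ y → ∣ y ∣ ≤ℚ ℕtoℚ (t ℕ.* entryBound V)) (ℕtoℚ t ⊙ lincombℚ μ W)
    scaled = All.map (subst (_ ≤ℚ_) (sym (ℕtoℚ-* t (entryBound V)))) (∣⊙∣≤ (ℕtoℚ-nonNeg t) point≤)

-- Counting lattice points

integersBetween : ℕ → List ℤ
integersBetween B = List.map ℤ.+_ (List.upTo (suc B)) ++ List.map ℤ.-[1+_] (List.upTo B)

∈-integersBetween : ∀ {B} c → ℤ.∣ c ∣ ≤ B → c ∈ integersBetween B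
∈-integersBetween (ℤ.+ n)     n≤B = ∈-++⁺ˡ (∈-map⁺ ℤ.+_ (∈-upTo⁺ (ℕ.s≤s n≤B)))
∈-integersBetween ℤ.-[1+ n ] n<B = ∈-++⁺ʳ _ (∈-map⁺ ℤ.-[1+_] (∈-upTo⁺ n<B))

box : ∀ d → ℕ → List (ℤ^ d)
box zero    B = [] ∷ []
box (suc d) B = cartesianProductWith _∷_ (integersBetween B) (box d B)

∈-box : ∀ {d B} (z : ℤ^ d) → All (λ c → ℤ.∣ c ∣ ≤ B) z → z ∈ box d B
∈-box []      []         = here refl
∈-box (c ∷ z) (c≤ ∷ z≤) = ∈-cartesianProductWith⁺ _∷_ (∈-integersBetween c c≤) (∈-box z z≤)

hasCount-⊆ : ∀ {d} {Q : ℤ^ d → Set} (candidates : List (ℤ^ d)) →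
             (∀ z → Dec (Q z)) → (∀ z → Q z → z ∈ candidates) → ∃ (HasCount Q)
hasCount-⊆ {d} candidates Q? Q⊆candidates =
  length xs , xs , Unique.deduplicate-! _≟_ (filter Q? candidates) , refl ,
  λ z → (λ z∈xs → proj₂ (∈-filter⁻ Q? {xs = candidates} (∈-deduplicate⁻ _≟_ (filter Q? candidates) z∈xs))) ,
        (λ Qz → ∈-deduplicate⁺ _≟_ (∈-filter⁺ Q? (Q⊆candidates z Qz) Qz))
  where
  _≟_ : DecidableEquality (ℤ^ d)
  _≟_ = Vec.≡-dec ℤ._≟_
  xs = deduplicate _≟_ (filter Q? candidates)

hasCount-cong : ∀ {d} {Q R : ℤ^ d → Set} {m} → (∀ a → Q a ⇔ R a) → HasCount Q m → HasCount R m
hasCount-cong Q⇔R (xs , unique , length≡ , mem) =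
  xs , unique , length≡ , λ a → Equivalence.to (Q⇔R a) ∘ proj₁ (mem a) , proj₂ (mem a) ∘ Equivalence.from (Q⇔R a)

latticeCount : ∀ {d} (P : LatticePolytope d) t → ∃ (LatticeCount P t)
latticeCount (polytope k V) t = hasCount-⊆ (box _ (t ℕ.* entryBound V)) (λ z → inDilate? V t (embed z))
                                           (λ z z∈tP → ∈-box z (inDilate-bounded V t z z∈tP))

lemma1 : (d : ℕ) (P : LatticePolytope d) (n : ℕ) → 1 ≤ n →
         (i : ℕ) → 1 ≤ i → i ≤ n →
         Σ ℕ λ m → LatticeCount P (n ∸ i) m ×
                   HasCount (λ a → TranslateInside i a n P) m
lemma1 d P@(polytope k V) n 1≤n i _ i≤n =
  proj₁ count , proj₂ count , hasCount-cong translate⇔ (proj₂ count)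
  where
  count = latticeCount P (n ∸ i)
  translate⇔ : ∀ a → InDilate (n ∸ i) P (embed a) ⇔ TranslateInside i a n P
  translate⇔ a = mk⇔ (translateInside⁺ V a 1≤n i≤n) (translateInside⁻ V a i≤n)
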